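{- Let $H=(V,E)$ be a finite hypergraph and let $N(H)$ be the number of edge sets $F\subseteq E$ such that $(V,F)$ is a connected hyperforest. Then $$\Bigl|\sum_{\substack{E'\subseteq E,\\ (V,E')\text{ connected}}}(-1)^{|E'|}\Bigr|\le N(H).$$
   Context: A hypergraph $H=(V,E)$ has a finite vertex set $V$ and a set $E$ of nonempty subsets of $V$ (edges). A hypergraph $(V',E')$ is connected if for every partition $V'=V_1\cup V_2$ into two nonempty sets some edge of $E'$ intersects both $V_1$ and $V_2$. For $X\subseteq V'$, $\Gamma(X)$ denotes the set of edges $e\in E'$ with $e\cap X\neq\emptyset$. A hypergraph $(V',E')$ is a hypercircuit if $|V'|=|E'|$ and $|\Gamma(X)|\ge |X|+1$ for every nonempty proper subset $X\subsetneq V'$. A hypergraph is a hyperforest if it contains no sub-hypergraph that is a hypercircuit. $N(H)$ thus counts the connected spanning hyperforests of $H$. -}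

module Defs where

open import Data.Bool using (Bool; true; false; _∧_; _∨_; not; if_then_else_)
open import Data.Nat using (ℕ; zero; suc; _≡ᵇ_; _≤ᵇ_; _+_)
open import Data.Integer using (ℤ; +_; -_)
import Data.Integer as ℤ
open import Data.Fin using (Fin)
open import Data.Fin.Subset using (Subset; ∁; _∩_; ∣_∣; inside)
open import Data.Vec using (Vec; []; _∷_; lookup)
import Data.Vec as Vec
open import Data.List using (List; []; _∷_; map; _++_; filter; length; allFin)
open import Data.Bool.ListAction using (all; any)
import Data.List as List
open import Relation.Nullary.Decidable using (Dec)
open import Data.Bool.Properties using (T?)

-- A finite hypergraph with vertex set Fin n and edge set given by an
-- indexing E : Fin m → Subset n (injectivity / nonemptiness of edges are
-- hypotheses of the theorem).  Sets of edges are Subset m (sets of indices).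

nonemptyᵇ : ∀ {n} → Subset n → Bool
nonemptyᵇ = Vec.foldr _ _∨_ false

meets : ∀ {n} → Subset n → Subset n → Bool
meets a b = nonemptyᵇ (a ∩ b)

⊆ᵇ : ∀ {n} → Subset n → Subset n → Bool
⊆ᵇ a b = Vec.foldr _ _∧_ true (Vec.zipWith (λ x y → not x ∨ y) a b)

≡ᵇ-sub : ∀ {n} → Subset n → Subset n → Bool
≡ᵇ-sub a b = ⊆ᵇ a b ∧ ⊆ᵇ b a

allSubsets : (k : ℕ) → List (Subset k)
allSubsets zero = [] ∷ []
allSubsets (suc k) = map (false ∷_) (allSubsets k) ++ map (true ∷_) (allSubsets k)

module _ {n m : ℕ} (E : Fin m → Subset n) where

  connectedᵇ : Subset m → Bool
  connectedᵇ F =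
    all (λ X → not (nonemptyᵇ X ∧ nonemptyᵇ (∁ X))
               ∨ any (λ i → lookup F i ∧ meets (E i) X ∧ meets (E i) (∁ X)) (allFin m))
        (allSubsets n)

  Γcount : Subset m → Subset n → ℕ
  Γcount E' X = length (filter (λ i → T? (lookup E' i ∧ meets (E i) X)) (allFin m))

  hypercircuitᵇ : Subset n → Subset m → Bool
  hypercircuitᵇ V' E' =
    nonemptyᵇ V'
    ∧ all (λ i → not (lookup E' i) ∨ ⊆ᵇ (E i) V') (allFin m)
    ∧ (∣ V' ∣ ≡ᵇ ∣ E' ∣)
    ∧ all (λ X → not (⊆ᵇ X V' ∧ nonemptyᵇ X ∧ not (≡ᵇ-sub X V'))
                 ∨ (suc ∣ X ∣ ≤ᵇ Γcount E' X))
          (allSubsets n)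

  hyperforestᵇ : Subset m → Bool
  hyperforestᵇ F =
    all (λ V' → all (λ E' → not (⊆ᵇ E' F ∧ hypercircuitᵇ V' E')) (allSubsets m))
        (allSubsets n)

  N : ℕ
  N = length (filter (λ F → T? (connectedᵇ F ∧ hyperforestᵇ F)) (allSubsets m))

  sign : ℕ → ℤ
  sign zero = + 1
  sign (suc k) = - sign k

  connectedSignedSum : ℤ
  connectedSignedSum =
    List.foldr ℤ._+_ (+ 0)
      (map (λ F → if connectedᵇ F then sign ∣ F ∣ else + 0) (allSubsets m))

-- The only property of connectivity needed is that inserting an edge e which
-- closes a hypercircuit C with a hyperforest of edges already present does not
-- change connectedness.  Indeed, if e were the only edge crossing a cut
-- (X, V ∖ X), then only e could meet both A = C ∩ X and B = C ∖ X, so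
-- |Γ(A)| + |Γ(B)| ≤ |C| + 1 = |A| + |B| + 1, against the expansion
-- |Γ(A)| ≥ |A| + 1 and |Γ(B)| ≥ |B| + 1 of a hypercircuit.
-- Then induct on the edges, splitting the edge sets by whether they contain the
-- first edge e; in the half containing e, hyperforests are taken relative to the
-- edges fixed so far.  If fixing e already creates a hypercircuit, the two halves
-- of the signed sum cancel; otherwise each is bounded by induction and the
-- triangle inequality adds the bounds.
module Submission where

open import Defs
open import Data.Bool using (Bool; true; false; T; not; _∧_; _∨_; if_then_else_)
open import Data.Bool.ListAction using (all; any)
open import Data.Bool.Properties using (T?; T-≡; T-∧)
open import Data.Empty using (⊥-elim)
open import Data.Fin using (Fin; zero; suc; _≟_)
import Data.Fin.Properties as Fin
open import Data.Fin.Subset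
  using (Subset; inside; outside; ⊥; ∁; _∩_; _∪_; ⁅_⁆; _∈_; _⊆_; _⊂_; Nonempty; ∣_∣)
open import Data.Fin.Subset.Properties
  using ( _∈?_; nonempty?; out⊆; in⊆in; drop-∷-⊆; s⊆s; ⊥⊆; ∣⊥∣≡0; x∈⁅x⁆; ∣⁅x⁆∣≡1
        ; p⊆q⇒∣p∣≤∣q∣; x∈p⇒∣p-x∣<∣p∣; x∈p∩q⁺; x∈p∩q⁻; x∈p∪q⁻; p∩q⊆p; p∩q⊆q
        ; x∈p⇒x∉∁p )
open import Data.Integer using (ℤ; -_; _-_; 0ℤ; -1ℤ; _^_)
import Data.Integer as ℤ
import Data.Integer.Properties as ℤ
open import Data.List using (List; []; _∷_; map; _++_; filter; length; foldr; allFin)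
import Data.List as List
import Data.List.Properties as List
open import Data.List.Membership.Propositional using (lose) renaming (_∈_ to _∈ₗ_)
open import Data.List.Membership.Propositional.Properties using (∈-map⁺; ∈-++⁺ˡ; ∈-++⁺ʳ; ∈-allFin)
open import Data.List.Relation.Unary.All as All using ()
open import Data.List.Relation.Unary.All.Properties using (all⁺; all⁻; ¬All⇒Any¬)
open import Data.List.Relation.Unary.Any as Any using (satisfied)
open import Data.List.Relation.Unary.Any.Properties using (any⁺; any⁻)
open import Data.Nat using (ℕ; zero; suc; _+_; _≤_; _<_; _≡ᵇ_; _≤ᵇ_; z≤n; s≤s)
import Data.Nat.Properties as ℕ
open import Data.Product using (∃; ∃₂; _×_; _,_; proj₁; proj₂)
open import Data.Product.Function.NonDependent.Propositional using (_×-⇔_)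
open import Data.Sum using (inj₁; inj₂)
open import Data.Unit using (tt)
open import Data.Vec using ([]; _∷_; here; there; lookup; tabulate; _[_]≔_)
open import Data.Vec.Properties using ([]=⇒lookup; lookup⇒[]=; lookup∘tabulate; []≔-updates; []≔-minimal; lookup∘updateAt′)
open import Function using (_∘_; id; const)
open import Function.Bundles using (_⇔_; mk⇔; Equivalence)
open import Function.Construct.Composition using (_⇔-∘_)
open import Function.Definitions using (Injective)
open import Relation.Binary.PropositionalEquality
open import Relation.Nullary using (¬_; Dec; yes; no; ¬?; _×-dec_; contradiction)
open import Relation.Nullary.Decidable using (decidable-stable)

open Equivalence using (to; from)

-- Boolean reflection

T-not : ∀ {x} → T (not x) ⇔ (¬ T x)
T-not {true}  = mk⇔ (λ ()) (λ ¬t → ¬t tt)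
T-not {false} = mk⇔ (λ _ ()) (const tt)

T-not-∨ : ∀ {x y} → T (not x ∨ y) ⇔ (T x → T y)
T-not-∨ {true}  = mk⇔ (λ t _ → t) (λ f → f tt)
T-not-∨ {false} = mk⇔ (λ _ ()) (const tt)

¬T-not⇒T : ∀ {x} → ¬ T (not x) → T x
¬T-not⇒T ¬t = decidable-stable (T? _) (¬t ∘ from T-not)

T⇔T⇒≡ : ∀ {x y} → (T x ⇔ T y) → x ≡ y
T⇔T⇒≡ {true}  {true}  _   = refl
T⇔T⇒≡ {true}  {false} x⇔y = ⊥-elim (to x⇔y tt)
T⇔T⇒≡ {false} {true}  x⇔y = ⊥-elim (from x⇔y tt)
T⇔T⇒≡ {false} {false} _   = refl

module _ {A : Set} {xs : List A} (complete : ∀ x → x ∈ₗ xs) (P : A → Bool) where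

  T-all-complete : T (all P xs) ⇔ (∀ x → T (P x))
  T-all-complete =
    mk⇔ (λ t x → All.lookup (all⁺ P xs t) (complete x))
        (λ f → all⁻ P {xs} (All.tabulate (λ {x} _ → f x)))

  T-any-complete : T (any P xs) ⇔ ∃ λ x → T (P x)
  T-any-complete =
    mk⇔ (satisfied ∘ any⁻ P xs) (λ (x , px) → any⁺ P (lose (complete x) px))

¬T-all : ∀ {A : Set} (P : A → Bool) xs → ¬ T (all P xs) → ∃ λ x → ¬ T (P x)
¬T-all P xs ¬t = satisfied (¬All⇒Any¬ (T? ∘ P) xs (¬t ∘ all⁻ P))

∈-allSubsets : ∀ {n} (p : Subset n) → p ∈ₗ allSubsets n
∈-allSubsets []            = Any.here refl
∈-allSubsets (outside ∷ p) = ∈-++⁺ˡ (∈-map⁺ (outside ∷_) (∈-allSubsets p))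
∈-allSubsets {suc n} (inside ∷ p) =
  ∈-++⁺ʳ (map (outside ∷_) (allSubsets n)) (∈-map⁺ (inside ∷_) (∈-allSubsets p))

T-lookup : ∀ {n} {p : Subset n} {x} → T (lookup p x) ⇔ x ∈ p
T-lookup {p = p} {x} = mk⇔ (lookup⇒[]= x p ∘ to T-≡) (from T-≡ ∘ []=⇒lookup)

T-nonemptyᵇ : ∀ {n} {p : Subset n} → T (nonemptyᵇ p) ⇔ Nonempty p
T-nonemptyᵇ {p = []}          = mk⇔ (λ ()) (λ { (() , _) })
T-nonemptyᵇ {p = inside ∷ p}  = mk⇔ (const (zero , here)) (const tt)
T-nonemptyᵇ {p = outside ∷ p} = mk⇔ shift unshift
  where
  shift : T (nonemptyᵇ p) → Nonempty (outside ∷ p)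
  shift t = let x , x∈p = to T-nonemptyᵇ t in suc x , there x∈p
  unshift : Nonempty (outside ∷ p) → T (nonemptyᵇ p)
  unshift (suc x , there x∈p) = from T-nonemptyᵇ (x , x∈p)

T-⊆ᵇ : ∀ {n} {p q : Subset n} → T (⊆ᵇ p q) ⇔ p ⊆ q
T-⊆ᵇ {p = []}          {[]}          = mk⇔ (λ _ ()) (const tt)
T-⊆ᵇ {p = outside ∷ p} {_ ∷ q}       = mk⇔ (out⊆ ∘ to T-⊆ᵇ) (from T-⊆ᵇ ∘ drop-∷-⊆)
T-⊆ᵇ {p = inside ∷ p}  {inside ∷ q}  = mk⇔ (in⊆in ∘ to T-⊆ᵇ) (from T-⊆ᵇ ∘ drop-∷-⊆)
T-⊆ᵇ {p = inside ∷ p}  {outside ∷ q} = mk⇔ (λ ()) (λ p⊆q → contradiction (p⊆q here) λ ())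

⊆-insert : ∀ {n} {p : Subset n} e → p ⊆ p [ e ]≔ inside
⊆-insert e {x} x∈p with x ≟ e
... | yes refl = []≔-updates _ e
... | no  x≢e  = []≔-minimal _ x e x≢e x∈p

∈-insert⁻ : ∀ {n} {p : Subset n} {x e} → x ≢ e → x ∈ p [ e ]≔ inside → x ∈ p
∈-insert⁻ {p = p} {x} {e} x≢e x∈p′ =
  lookup⇒[]= x p (trans (sym (lookup∘updateAt′ x e x≢e p)) ([]=⇒lookup x∈p′))

nonempty-mono : ∀ {n} {p q : Subset n} → p ⊆ q → Nonempty p → Nonempty q
nonempty-mono p⊆q (x , x∈p) = x , p⊆q x∈p

0<∣p∣ : ∀ {n} {p : Subset n} → Nonempty p → 0 < ∣ p ∣
0<∣p∣ (_ , x∈p) = ℕ.<-≤-trans (s≤s z≤n) (x∈p⇒∣p-x∣<∣p∣ x∈p)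

∣p∣+∣q∣≡∣p∪q∣+∣p∩q∣ : ∀ {n} (p q : Subset n) → ∣ p ∣ + ∣ q ∣ ≡ ∣ p ∪ q ∣ + ∣ p ∩ q ∣
∣p∣+∣q∣≡∣p∪q∣+∣p∩q∣ []            []            = refl
∣p∣+∣q∣≡∣p∪q∣+∣p∩q∣ (outside ∷ p) (outside ∷ q) = ∣p∣+∣q∣≡∣p∪q∣+∣p∩q∣ p q
∣p∣+∣q∣≡∣p∪q∣+∣p∩q∣ (inside ∷ p)  (outside ∷ q) = cong suc (∣p∣+∣q∣≡∣p∪q∣+∣p∩q∣ p q)
∣p∣+∣q∣≡∣p∪q∣+∣p∩q∣ (outside ∷ p) (inside ∷ q)  =
  trans (ℕ.+-suc ∣ p ∣ ∣ q ∣) (cong suc (∣p∣+∣q∣≡∣p∪q∣+∣p∩q∣ p q))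
∣p∣+∣q∣≡∣p∪q∣+∣p∩q∣ (inside ∷ p)  (inside ∷ q)  = cong suc (begin
  ∣ p ∣ + suc ∣ q ∣             ≡⟨ ℕ.+-suc ∣ p ∣ ∣ q ∣ ⟩
  suc (∣ p ∣ + ∣ q ∣)           ≡⟨ cong suc (∣p∣+∣q∣≡∣p∪q∣+∣p∩q∣ p q) ⟩
  suc (∣ p ∪ q ∣ + ∣ p ∩ q ∣)   ≡⟨ ℕ.+-suc ∣ p ∪ q ∣ ∣ p ∩ q ∣ ⟨
  ∣ p ∪ q ∣ + suc ∣ p ∩ q ∣     ∎)
  where open ≡-Reasoning

∣p∩q∣+∣p∩∁q∣≡∣p∣ : ∀ {n} (p q : Subset n) → ∣ p ∩ q ∣ + ∣ p ∩ ∁ q ∣ ≡ ∣ p ∣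
∣p∩q∣+∣p∩∁q∣≡∣p∣ []            []            = refl
∣p∩q∣+∣p∩∁q∣≡∣p∣ (outside ∷ p) (_ ∷ q)       = ∣p∩q∣+∣p∩∁q∣≡∣p∣ p q
∣p∩q∣+∣p∩∁q∣≡∣p∣ (inside ∷ p)  (inside ∷ q)  = cong suc (∣p∩q∣+∣p∩∁q∣≡∣p∣ p q)
∣p∩q∣+∣p∩∁q∣≡∣p∣ (inside ∷ p)  (outside ∷ q) =
  trans (ℕ.+-suc ∣ p ∩ q ∣ ∣ p ∩ ∁ q ∣) (cong suc (∣p∩q∣+∣p∩∁q∣≡∣p∣ p q))

length-filter-tabulate : ∀ {A : Set} {m} (p : A → Bool) (f : Fin m → A) →
  length (filter (T? ∘ p) (List.tabulate f)) ≡ ∣ tabulate (p ∘ f) ∣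
length-filter-tabulate {m = zero}  p f = refl
length-filter-tabulate {m = suc m} p f with p (f zero)
... | true  = cong suc (length-filter-tabulate p (f ∘ suc))
... | false = length-filter-tabulate p (f ∘ suc)

-- Signed sums over all subsets

sumℤ : List ℤ → ℤ
sumℤ = foldr ℤ._+_ 0ℤ

sumℤ-++ : ∀ xs ys → sumℤ (xs ++ ys) ≡ sumℤ xs ℤ.+ sumℤ ys
sumℤ-++ []       ys = sym (ℤ.+-identityˡ (sumℤ ys))
sumℤ-++ (x ∷ xs) ys =
  trans (cong (ℤ._+_ x) (sumℤ-++ xs ys)) (sym (ℤ.+-assoc x (sumℤ xs) (sumℤ ys)))

sumℤ-neg : ∀ xs → sumℤ (map -_ xs) ≡ - sumℤ xs
sumℤ-neg []       = refl
sumℤ-neg (x ∷ xs) =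
  trans (cong (ℤ._+_ (- x)) (sumℤ-neg xs)) (sym (ℤ.neg-distrib-+ x (sumℤ xs)))

signedSum : ∀ {k} → (Subset k → Bool) → ℤ
signedSum {k} c = sumℤ (map (λ F → if c F then -1ℤ ^ ∣ F ∣ else 0ℤ) (allSubsets k))

count : ∀ {k} → (Subset k → Bool) → ℕ
count {k} p = length (filter (T? ∘ p) (allSubsets k))

signedSum-cong : ∀ {k} {c d : Subset k → Bool} → (∀ F → c F ≡ d F) → signedSum c ≡ signedSum d
signedSum-cong {k} c≗d =
  cong sumℤ (List.map-cong (λ F → cong (λ b → if b then -1ℤ ^ ∣ F ∣ else 0ℤ) (c≗d F)) (allSubsets k))

signedSum-∷ : ∀ {k} (c : Subset (suc k) → Bool) →
  signedSum c ≡ signedSum (c ∘ (outside ∷_)) - signedSum (c ∘ (inside ∷_))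
signedSum-∷ {k} c = begin
  sumℤ (map w (map (outside ∷_) Fs ++ map (inside ∷_) Fs))
    ≡⟨ cong sumℤ (List.map-++ w (map (outside ∷_) Fs) _) ⟩
  sumℤ (map w (map (outside ∷_) Fs) ++ map w (map (inside ∷_) Fs))
    ≡⟨ sumℤ-++ (map w (map (outside ∷_) Fs)) _ ⟩
  sumℤ (map w (map (outside ∷_) Fs)) ℤ.+ sumℤ (map w (map (inside ∷_) Fs))
    ≡⟨ cong₂ (λ xs ys → sumℤ xs ℤ.+ sumℤ ys) (List.map-∘ Fs) (List.map-∘ Fs) ⟨
  signedSum (c ∘ (outside ∷_)) ℤ.+ sumℤ (map (w ∘ (inside ∷_)) Fs)
    ≡⟨ cong (λ xs → signedSum (c ∘ (outside ∷_)) ℤ.+ sumℤ xs)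
            (trans (List.map-cong flip-sign Fs) (List.map-∘ Fs)) ⟩
  signedSum (c ∘ (outside ∷_)) ℤ.+ sumℤ (map -_ (map w₁ Fs))
    ≡⟨ cong (ℤ._+_ (signedSum (c ∘ (outside ∷_)))) (sumℤ-neg (map w₁ Fs)) ⟩
  signedSum (c ∘ (outside ∷_)) - signedSum (c ∘ (inside ∷_))
    ∎
  where
  open ≡-Reasoning
  Fs = allSubsets k
  w : Subset (suc k) → ℤ
  w F = if c F then -1ℤ ^ ∣ F ∣ else 0ℤ
  w₁ : Subset k → ℤ
  w₁ F = if c (inside ∷ F) then -1ℤ ^ ∣ F ∣ else 0ℤ
  flip-sign : ∀ F → w (inside ∷ F) ≡ - w₁ F
  flip-sign F with c (inside ∷ F)
  ... | true  = ℤ.-1*i≡-i (-1ℤ ^ ∣ F ∣)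
  ... | false = refl

length-filter-map : ∀ {A B : Set} (p : B → Bool) (f : A → B) xs →
  length (filter (T? ∘ p) (map f xs)) ≡ length (filter (T? ∘ p ∘ f) xs)
length-filter-map p f []       = refl
length-filter-map p f (x ∷ xs) with p (f x)
... | true  = cong suc (length-filter-map p f xs)
... | false = length-filter-map p f xs

count-∷ : ∀ {k} (p : Subset (suc k) → Bool) →
  count p ≡ count (p ∘ (outside ∷_)) + count (p ∘ (inside ∷_))
count-∷ {k} p = begin
  length (filter (T? ∘ p) (map (outside ∷_) Fs ++ map (inside ∷_) Fs))
    ≡⟨ cong length (List.filter-++ (T? ∘ p) (map (outside ∷_) Fs) _) ⟩
  length (filter (T? ∘ p) (map (outside ∷_) Fs) ++ filter (T? ∘ p) (map (inside ∷_) Fs))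
    ≡⟨ List.length-++ (filter (T? ∘ p) (map (outside ∷_) Fs)) ⟩
  length (filter (T? ∘ p) (map (outside ∷_) Fs)) + length (filter (T? ∘ p) (map (inside ∷_) Fs))
    ≡⟨ cong₂ _+_ (length-filter-map p (outside ∷_) Fs) (length-filter-map p (inside ∷_) Fs) ⟩
  count (p ∘ (outside ∷_)) + count (p ∘ (inside ∷_))
    ∎
  where
  open ≡-Reasoning
  Fs = allSubsets k

DependentInsertionInvariant : ∀ {k} → (c h : Subset k → Bool) → Set
DependentInsertionInvariant c h =
  ∀ {K G e} → K ⊆ G → T (h K) → ¬ T (h (K [ e ]≔ inside)) → c (G [ e ]≔ inside) ≡ c G

DependentInsertionInvariant-∷ : ∀ {k} {c h : Subset (suc k) → Bool} s →
  DependentInsertionInvariant c h → DependentInsertionInvariant (c ∘ (s ∷_)) (h ∘ (s ∷_))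
DependentInsertionInvariant-∷ s invariant {e = e} K⊆G = invariant {e = suc e} (s⊆s K⊆G)

∣signedSum∣≤count : ∀ {k} (c h : Subset k → Bool) → T (h ⊥) →
  DependentInsertionInvariant c h → ℤ.∣ signedSum c ∣ ≤ count (λ F → c F ∧ h F)
∣signedSum∣≤count {zero} c h h⊥ _ with c [] | h []
... | true  | true  = ℕ.≤-refl
... | true  | false = ⊥-elim h⊥
... | false | _     = z≤n
∣signedSum∣≤count {suc k} c h h⊥ invariant with h (inside ∷ ⊥) in h⁅0⁆
... | true = begin
  ℤ.∣ signedSum c ∣                       ≡⟨ cong ℤ.∣_∣ (signedSum-∷ c) ⟩
  ℤ.∣ signedSum c₀ - signedSum c₁ ∣       ≤⟨ ℤ.∣i-j∣≤∣i∣+∣j∣ (signedSum c₀) (signedSum c₁) ⟩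
  ℤ.∣ signedSum c₀ ∣ + ℤ.∣ signedSum c₁ ∣ ≤⟨ ℕ.+-mono-≤ bound₀ bound₁ ⟩
  count (p ∘ (outside ∷_)) + count (p ∘ (inside ∷_)) ≡⟨ count-∷ p ⟨
  count p                                 ∎
  where
  open ℕ.≤-Reasoning
  c₀ = c ∘ (outside ∷_)
  c₁ = c ∘ (inside ∷_)
  p = λ F → c F ∧ h F
  bound₀ = ∣signedSum∣≤count c₀ (h ∘ (outside ∷_)) h⊥ (DependentInsertionInvariant-∷ outside invariant)
  bound₁ = ∣signedSum∣≤count c₁ (h ∘ (inside ∷_)) (from T-≡ h⁅0⁆) (DependentInsertionInvariant-∷ inside invariant)
... | false = begin
  ℤ.∣ signedSum c ∣                 ≡⟨ cong ℤ.∣_∣ (signedSum-∷ c) ⟩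
  ℤ.∣ signedSum c₀ - signedSum c₁ ∣ ≡⟨ cong (λ s → ℤ.∣ signedSum c₀ - s ∣) (signedSum-cong c₁≗c₀) ⟩
  ℤ.∣ signedSum c₀ - signedSum c₀ ∣ ≡⟨ cong ℤ.∣_∣ (ℤ.+-inverseʳ (signedSum c₀)) ⟩
  0                                 ≤⟨ z≤n ⟩
  count (λ F → c F ∧ h F)           ∎
  where
  open ℕ.≤-Reasoning
  c₀ = c ∘ (outside ∷_)
  c₁ = c ∘ (inside ∷_)
  c₁≗c₀ : ∀ F → c₁ F ≡ c₀ F
  c₁≗c₀ F = invariant {⊥} {outside ∷ F} {zero} ⊥⊆ h⊥ (λ t → subst T h⁅0⁆ t)

-- Hypergraphs

Crosses : ∀ {n} → Subset n → Subset n → Set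
Crosses a X = Nonempty (a ∩ X) × Nonempty (a ∩ ∁ X)

crosses? : ∀ {n} (a X : Subset n) → Dec (Crosses a X)
crosses? a X = nonempty? (a ∩ X) ×-dec nonempty? (a ∩ ∁ X)

T-crosses : ∀ {n} {a X : Subset n} → T (meets a X ∧ meets a (∁ X)) ⇔ Crosses a X
T-crosses = (T-nonemptyᵇ ×-⇔ T-nonemptyᵇ) ⇔-∘ T-∧

∩-monoʳ-⊆ : ∀ {n} (p : Subset n) {q r} → q ⊆ r → p ∩ q ⊆ p ∩ r
∩-monoʳ-⊆ p q⊆r x∈p∩q =
  let x∈p , x∈q = x∈p∩q⁻ p _ x∈p∩q in x∈p∩q⁺ (x∈p , q⊆r x∈q)

module _ {n m} (E : Fin m → Subset n) where

  Connected : Subset m → Set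
  Connected F = ∀ X → Nonempty X → Nonempty (∁ X) → ∃ λ i → i ∈ F × Crosses (E i) X

  Connected-mono : ∀ {F G} → F ⊆ G → Connected F → Connected G
  Connected-mono F⊆G connected X neX ne∁X =
    let i , i∈F , i-crosses = connected X neX ne∁X in i , F⊆G i∈F , i-crosses

  T-connectedᵇ : ∀ {F} → T (connectedᵇ E F) ⇔ Connected F
  T-connectedᵇ {F} = mk⇔
    (λ t X neX ne∁X → to crossing (to T-not-∨ (to (T-all-complete ∈-allSubsets _) t X)
                                                 (from sides (neX , ne∁X))))
    (λ connected → from (T-all-complete ∈-allSubsets _) λ X → from T-not-∨ λ t →
       let neX , ne∁X = to sides t in from crossing (connected X neX ne∁X))
    where
    sides : ∀ {X} → T (nonemptyᵇ X ∧ nonemptyᵇ (∁ X)) ⇔ (Nonempty X × Nonempty (∁ X))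
    sides = (T-nonemptyᵇ ×-⇔ T-nonemptyᵇ) ⇔-∘ T-∧
    edge : ∀ {X i} → T (lookup F i ∧ meets (E i) X ∧ meets (E i) (∁ X)) ⇔ (i ∈ F × Crosses (E i) X)
    edge = (T-lookup ×-⇔ T-crosses) ⇔-∘ T-∧
    crossing : ∀ {X} →
      T (any (λ i → lookup F i ∧ meets (E i) X ∧ meets (E i) (∁ X)) (allFin m)) ⇔
      (∃ λ i → i ∈ F × Crosses (E i) X)
    crossing = mk⇔
      (λ t → let i , ti = to (T-any-complete ∈-allFin _) t in i , to edge ti)
      (λ (i , i-crosses) → from (T-any-complete ∈-allFin _) (i , from edge i-crosses))

  Γ : Subset m → Subset n → Subset m
  Γ E' X = tabulate (λ i → lookup E' i ∧ meets (E i) X)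

  ∈Γ⇔ : ∀ E' X {i} → i ∈ Γ E' X ⇔ (i ∈ E' × Nonempty (E i ∩ X))
  ∈Γ⇔ E' X {i} = mk⇔
    (to parts ∘ subst T (lookup∘tabulate _ i) ∘ from T-lookup)
    (to T-lookup ∘ subst T (sym (lookup∘tabulate _ i)) ∘ from parts)
    where
    parts : T (lookup E' i ∧ meets (E i) X) ⇔ (i ∈ E' × Nonempty (E i ∩ X))
    parts = (T-lookup ×-⇔ T-nonemptyᵇ) ⇔-∘ T-∧

  Γcount≡∣Γ∣ : ∀ E' X → Γcount E E' X ≡ ∣ Γ E' X ∣
  Γcount≡∣Γ∣ E' X = length-filter-tabulate (λ i → lookup E' i ∧ meets (E i) X) id

  record IsHypercircuit (V' : Subset n) (E' : Subset m) : Set where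
    field
      nonempty  : Nonempty V'
      edges⊆    : ∀ {i} → i ∈ E' → E i ⊆ V'
      balanced  : ∣ V' ∣ ≡ ∣ E' ∣
      expanding : ∀ {X} → X ⊂ V' → Nonempty X → suc ∣ X ∣ ≤ ∣ Γ E' X ∣

  hypercircuitᵇ⇒IsHypercircuit : ∀ {V' E'} → T (hypercircuitᵇ E V' E') → IsHypercircuit V' E'
  hypercircuitᵇ⇒IsHypercircuit {V'} {E'} t =
    let ne , t₁    = to (T-∧ {nonemptyᵇ V'}) t
        edges , t₂ = to (T-∧ {all edge-inside (allFin m)}) t₁
        bal , exp  = to (T-∧ {∣ V' ∣ ≡ᵇ ∣ E' ∣}) t₂
    in record
    { nonempty  = to T-nonemptyᵇ ne
    ; edges⊆    = λ {i} i∈E' →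
        to T-⊆ᵇ (to T-not-∨ (to (T-all-complete ∈-allFin edge-inside) edges i) (from T-lookup i∈E'))
    ; balanced  = ℕ.≡ᵇ⇒≡ ∣ V' ∣ ∣ E' ∣ bal
    ; expanding = λ {X} X⊂V' neX →
        subst (suc ∣ X ∣ ≤_) (Γcount≡∣Γ∣ E' X)
          (ℕ.≤ᵇ⇒≤ _ _ (to T-not-∨ (to (T-all-complete ∈-allSubsets expands) exp X) (proper X⊂V' neX)))
    }
    where
    edge-inside : Fin m → Bool
    edge-inside i = not (lookup E' i) ∨ ⊆ᵇ (E i) V'
    expands : Subset n → Bool
    expands X = not (⊆ᵇ X V' ∧ nonemptyᵇ X ∧ not (≡ᵇ-sub X V')) ∨ (suc ∣ X ∣ ≤ᵇ Γcount E E' X)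
    proper : ∀ {X} → X ⊂ V' → Nonempty X → T (⊆ᵇ X V' ∧ nonemptyᵇ X ∧ not (≡ᵇ-sub X V'))
    proper {X} (X⊆V' , x , x∈V' , x∉X) neX =
      from T-∧ (from T-⊆ᵇ X⊆V' , from T-∧ (from T-nonemptyᵇ neX , from T-not λ X≡V' →
        x∉X (to T-⊆ᵇ (proj₂ (to (T-∧ {⊆ᵇ X V'}) X≡V')) x∈V')))

  hypercircuit-has-no-bridge : ∀ {V' E' e X} → IsHypercircuit V' E' → e ∈ E' → Crosses (E e) X →
    ∃ λ j → j ∈ E' × j ≢ e × Crosses (E j) X
  hypercircuit-has-no-bridge {V'} {E'} {e} {X} hc e∈E' ((v , v∈Ee∩X) , (w , w∈Ee∩∁X))
    with Fin.any? (λ j → j ∈? E' ×-dec ¬? (j ≟ e) ×-dec crosses? (E j) X)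
  ... | yes other = other
  ... | no  none  = ⊥-elim (ℕ.<-irrefl refl more-vertices-than-possible)
    where
    open IsHypercircuit hc
    A = V' ∩ X
    B = V' ∩ ∁ X
    v∈X = proj₂ (x∈p∩q⁻ (E e) X v∈Ee∩X)
    w∈∁X = proj₂ (x∈p∩q⁻ (E e) (∁ X) w∈Ee∩∁X)
    v∈V' = edges⊆ e∈E' (proj₁ (x∈p∩q⁻ (E e) X v∈Ee∩X))
    w∈V' = edges⊆ e∈E' (proj₁ (x∈p∩q⁻ (E e) (∁ X) w∈Ee∩∁X))

    A⊂V' : A ⊂ V'
    A⊂V' = p∩q⊆p V' X , w , w∈V' , λ w∈A → x∈p⇒x∉∁p (proj₂ (x∈p∩q⁻ V' X w∈A)) w∈∁X
    B⊂V' : B ⊂ V'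
    B⊂V' = p∩q⊆p V' (∁ X) , v , v∈V' , λ v∈B → x∈p⇒x∉∁p v∈X (proj₂ (x∈p∩q⁻ V' (∁ X) v∈B))

    ΓA∪ΓB⊆E' : Γ E' A ∪ Γ E' B ⊆ E'
    ΓA∪ΓB⊆E' j∈ΓA∪ΓB with x∈p∪q⁻ (Γ E' A) (Γ E' B) j∈ΓA∪ΓB
    ... | inj₁ j∈ΓA = proj₁ (to (∈Γ⇔ E' A) j∈ΓA)
    ... | inj₂ j∈ΓB = proj₁ (to (∈Γ⇔ E' B) j∈ΓB)

    ΓA∩ΓB⊆⁅e⁆ : Γ E' A ∩ Γ E' B ⊆ ⁅ e ⁆
    ΓA∩ΓB⊆⁅e⁆ {j} j∈ΓA∩ΓB with j ≟ e
    ... | yes refl = x∈⁅x⁆ e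
    ... | no  j≢e  =
      let j∈ΓA , j∈ΓB = x∈p∩q⁻ (Γ E' A) (Γ E' B) j∈ΓA∩ΓB
          j∈E' , Ej-meets-A = to (∈Γ⇔ E' A) j∈ΓA
          _    , Ej-meets-B = to (∈Γ⇔ E' B) j∈ΓB
      in ⊥-elim (none (j , j∈E' , j≢e ,
           nonempty-mono (∩-monoʳ-⊆ (E j) (p∩q⊆q V' X)) Ej-meets-A ,
           nonempty-mono (∩-monoʳ-⊆ (E j) (p∩q⊆q V' (∁ X))) Ej-meets-B))

    more-vertices-than-possible : suc (∣ A ∣ + ∣ B ∣) < suc (∣ A ∣ + ∣ B ∣)
    more-vertices-than-possible = begin
      suc (suc (∣ A ∣ + ∣ B ∣))          ≡⟨ cong suc (ℕ.+-suc ∣ A ∣ ∣ B ∣) ⟨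
      suc ∣ A ∣ + suc ∣ B ∣              ≤⟨ ℕ.+-mono-≤ (expanding A⊂V' (v , x∈p∩q⁺ (v∈V' , v∈X)))
                                                       (expanding B⊂V' (w , x∈p∩q⁺ (w∈V' , w∈∁X))) ⟩
      ∣ Γ E' A ∣ + ∣ Γ E' B ∣             ≡⟨ ∣p∣+∣q∣≡∣p∪q∣+∣p∩q∣ (Γ E' A) (Γ E' B) ⟩
      ∣ Γ E' A ∪ Γ E' B ∣ + ∣ Γ E' A ∩ Γ E' B ∣
                                        ≤⟨ ℕ.+-mono-≤ (p⊆q⇒∣p∣≤∣q∣ ΓA∪ΓB⊆E') (p⊆q⇒∣p∣≤∣q∣ ΓA∩ΓB⊆⁅e⁆) ⟩
      ∣ E' ∣ + ∣ ⁅ e ⁆ ∣                  ≡⟨ cong₂ _+_ (sym balanced) (∣⁅x⁆∣≡1 e) ⟩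
      ∣ V' ∣ + 1                          ≡⟨ cong (_+ 1) (∣p∩q∣+∣p∩∁q∣≡∣p∣ V' X) ⟨
      ∣ A ∣ + ∣ B ∣ + 1                   ≡⟨ ℕ.+-comm (∣ A ∣ + ∣ B ∣) 1 ⟩
      suc (∣ A ∣ + ∣ B ∣)                 ∎
      where open ℕ.≤-Reasoning

  T-hyperforestᵇ : ∀ {F} → T (hyperforestᵇ E F) ⇔ (∀ {V' E'} → E' ⊆ F → ¬ T (hypercircuitᵇ E V' E'))
  T-hyperforestᵇ {F} = mk⇔ forest⇒ ⇒forest
    where
    no-circuit : Subset n → Subset m → Bool
    no-circuit V' E' = not (⊆ᵇ E' F ∧ hypercircuitᵇ E V' E')
    no-circuits : Subset n → Bool
    no-circuits V' = all (no-circuit V') (allSubsets m)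
    forest⇒ : T (hyperforestᵇ E F) → ∀ {V' E'} → E' ⊆ F → ¬ T (hypercircuitᵇ E V' E')
    forest⇒ t {V'} {E'} E'⊆F circuit =
      to T-not (to (T-all-complete ∈-allSubsets (no-circuit V'))
                   (to (T-all-complete ∈-allSubsets no-circuits) t V') E')
        (from T-∧ (from T-⊆ᵇ E'⊆F , circuit))
    ⇒forest : (∀ {V' E'} → E' ⊆ F → ¬ T (hypercircuitᵇ E V' E')) → T (hyperforestᵇ E F)
    ⇒forest forest =
      from (T-all-complete ∈-allSubsets no-circuits) λ V' →
      from (T-all-complete ∈-allSubsets (no-circuit V')) λ E' →
      from T-not λ t →
        let E'⊆F , circuit = to (T-∧ {⊆ᵇ E' F}) t in forest {V'} {E'} (to T-⊆ᵇ E'⊆F) circuit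

  ¬hyperforestᵇ⇒hypercircuit : ∀ {F} → ¬ T (hyperforestᵇ E F) →
    ∃₂ λ V' E' → E' ⊆ F × T (hypercircuitᵇ E V' E')
  ¬hyperforestᵇ⇒hypercircuit {F} ¬forest =
    let V' , ¬t  = ¬T-all _ (allSubsets n) ¬forest
        E' , ¬t′ = ¬T-all _ (allSubsets m) ¬t
        E'⊆F , circuit = to (T-∧ {⊆ᵇ E' F}) (¬T-not⇒T ¬t′)
    in V' , E' , to T-⊆ᵇ E'⊆F , circuit

  hyperforest-⊥ : T (hyperforestᵇ E ⊥)
  hyperforest-⊥ = from T-hyperforestᵇ λ {V'} {E'} E'⊆⊥ circuit →
    let open IsHypercircuit (hypercircuitᵇ⇒IsHypercircuit {V'} {E'} circuit) in
    ℕ.<-irrefl refl (begin-strict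
      0        <⟨ 0<∣p∣ nonempty ⟩
      ∣ V' ∣   ≡⟨ balanced ⟩
      ∣ E' ∣   ≤⟨ p⊆q⇒∣p∣≤∣q∣ E'⊆⊥ ⟩
      ∣ ⊥ {m} ∣ ≡⟨ ∣⊥∣≡0 m ⟩
      0        ∎)
    where open ℕ.≤-Reasoning

  hypercircuit-contains-inserted : ∀ {K e V' C} → T (hyperforestᵇ E K) → C ⊆ K [ e ]≔ inside →
    T (hypercircuitᵇ E V' C) → e ∈ C
  hypercircuit-contains-inserted {e = e} {V'} {C} forest C⊆K+e circuit =
    decidable-stable (e ∈? C) λ e∉C →
      to T-hyperforestᵇ forest {V'} {C} (λ j∈C → ∈-insert⁻ (λ { refl → e∉C j∈C }) (C⊆K+e j∈C)) circuit

  connected-insert-dependent : ∀ {K G e} → K ⊆ G → T (hyperforestᵇ E K) →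
    ¬ T (hyperforestᵇ E (K [ e ]≔ inside)) → Connected (G [ e ]≔ inside) → Connected G
  connected-insert-dependent {K} {G} {e} K⊆G forest ¬forest connected X neX ne∁X
    with ¬hyperforestᵇ⇒hypercircuit ¬forest | connected X neX ne∁X
  ... | V' , C , C⊆K+e , circuit | i , i∈G+e , i-crosses with i ≟ e
  ...   | no  i≢e  = i , ∈-insert⁻ i≢e i∈G+e , i-crosses
  ...   | yes refl =
    let j , j∈C , j≢e , j-crosses =
          hypercircuit-has-no-bridge (hypercircuitᵇ⇒IsHypercircuit {V'} {C} circuit)
            (hypercircuit-contains-inserted {V' = V'} forest C⊆K+e circuit) i-crosses
    in j , K⊆G (∈-insert⁻ j≢e (C⊆K+e j∈C)) , j-crosses

  connectedᵇ-invariant : DependentInsertionInvariant (connectedᵇ E) (hyperforestᵇ E)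
  connectedᵇ-invariant {G = G} {e} K⊆G forest ¬forest = T⇔T⇒≡ (mk⇔
    (from T-connectedᵇ ∘ connected-insert-dependent K⊆G forest ¬forest ∘ to T-connectedᵇ)
    (from T-connectedᵇ ∘ Connected-mono (⊆-insert {p = G} e) ∘ to T-connectedᵇ))

  sign≡-1^ : ∀ k → sign E k ≡ -1ℤ ^ k
  sign≡-1^ zero    = refl
  sign≡-1^ (suc k) = trans (cong -_ (sign≡-1^ k)) (sym (ℤ.-1*i≡-i (-1ℤ ^ k)))

  connectedSignedSum≡signedSum : connectedSignedSum E ≡ signedSum (connectedᵇ E)
  connectedSignedSum≡signedSum = cong sumℤ (List.map-cong
    (λ F → cong (λ s → if connectedᵇ E F then s else 0ℤ) (sign≡-1^ ∣ F ∣)) (allSubsets m))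

theorem2 : (n m : ℕ) (E : Fin m → Subset n)
           → Injective _≡_ _≡_ E
           → (∀ i → Nonempty (E i))
           → ℤ.∣ connectedSignedSum E ∣ ≤ N E
theorem2 n m E _ _ = begin
  ℤ.∣ connectedSignedSum E ∣        ≡⟨ cong ℤ.∣_∣ (connectedSignedSum≡signedSum E) ⟩
  ℤ.∣ signedSum (connectedᵇ E) ∣    ≤⟨ ∣signedSum∣≤count (connectedᵇ E) (hyperforestᵇ E)
                                         (hyperforest-⊥ E) (connectedᵇ-invariant E) ⟩
  N E                               ∎
  where open ℕ.≤-Reasoning
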